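{- Let $D=(V_1,V_2;A)$ be a split digraph such that every vertex of $V_1$ has out-degree and in-degree at least $3$ in $D$. Then $D$ has a strong arc decomposition if one of the following holds: (i) $D$ is 2-arc-strong and $|V_2|\le 3$; (ii) $D\langle V_2\rangle$ is isomorphic to one of the directed multigraphs $S_4,S_{4,1},S_{4,2},S_{4,3}$.
   Context: Digraphs have no loops and no parallel arcs; directed multigraphs may have parallel arcs but no loops. A digraph is semicomplete if every two distinct vertices are joined by at least one arc. A split digraph $D=(V_1,V_2;A)$ is a digraph whose vertex set is the disjoint union of two non-empty sets $V_1,V_2$ such that $V_1$ is independent and the subdigraph induced by $V_2$ (denoted $D\langle V_2\rangle$) is semicomplete. A directed multigraph is strong if there is a directed path from $x$ to $y$ for every ordered pair of distinct vertices; it is $k$-arc-strong if it stays strong after deleting any at most $k-1$ arcs; a strong arc decomposition of $(V,A)$ is a partition of $A$ into $A_1,A_2$ with $(V,A_1),(V,A_2)$ both strong. $S_4$ is the digraph on $\{v_1,v_2,v_3,v_4\}$ with arcs $v_1v_2,v_2v_3,v_3v_4,v_4v_1,v_1v_3,v_3v_1,v_2v_4,v_4v_2$; $S_{4,1}$ is $S_4$ with one extra parallel copy of $v_3v_1$; $S_{4,2}$ is $S_4$ with one extra parallel copy of $v_1v_2$; $S_{4,3}$ is $S_4$ with one extra parallel copy of each of $v_3v_1$ and $v_2v_4$. -}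

module Defs where

open import Data.Nat using (ℕ; zero; suc; _+_; _≤_; _∸_)
open import Data.Fin using (Fin; zero; suc)
open import Data.Bool using (Bool; true; false)
open import Data.List using (map; allFin)
open import Data.Nat.ListAction using (sum)
open import Data.Product using (Σ; _×_; ∃; ∃-syntax)
open import Data.Sum using (_⊎_)
open import Relation.Binary.PropositionalEquality using (_≡_; _≢_)
open import Relation.Nullary using (¬_; Dec; yes; no)
open import Data.Fin using (_≟_)
open import Function.Definitions using (Injective)

-- A directed multigraph on vertex set Fin n, given by its arc-multiplicity
-- function: mult x y = number of (parallel) arcs from x to y.
record Multi (n : ℕ) : Set where
  field
    mult   : Fin n → Fin n → ℕ
    noLoop : ∀ x → mult x x ≡ 0
open Multi public

IsDigraph : ∀ {n} → Multi n → Set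
IsDigraph D = ∀ x y → mult D x y ≤ 1

outdeg : ∀ {n} → Multi n → Fin n → ℕ
outdeg {n} D x = sum (map (λ y → mult D x y) (allFin n))

indeg : ∀ {n} → Multi n → Fin n → ℕ
indeg {n} D x = sum (map (λ y → mult D y x) (allFin n))

-- directed reachability along arcs (paths; walks suffice)
data Reach {n : ℕ} (m : Fin n → Fin n → ℕ) : Fin n → Fin n → Set where
  here : ∀ {x} → Reach m x x
  step : ∀ {x z y} → 1 ≤ m x z → Reach m z y → Reach m x y

Strong : ∀ {n} → (Fin n → Fin n → ℕ) → Set
Strong {n} m = ∀ (x y : Fin n) → Reach m x y

deleteArc : ∀ {n} → (Fin n → Fin n → ℕ) → Fin n → Fin n → (Fin n → Fin n → ℕ)
deleteArc m a b x y with x ≟ a | y ≟ b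
... | yes _ | yes _ = m x y ∸ 1
... | _     | _     = m x y

TwoArcStrong : ∀ {n} → Multi n → Set
TwoArcStrong {n} D = Strong (mult D) ×
  (∀ (a b : Fin n) → 1 ≤ mult D a b → Strong (deleteArc (mult D) a b))

HasStrongArcDecomposition : ∀ {n} → Multi n → Set
HasStrongArcDecomposition {n} D =
  Σ (Fin n → Fin n → ℕ) λ m₁ → Σ (Fin n → Fin n → ℕ) λ m₂ →
    (∀ x y → m₁ x y + m₂ x y ≡ mult D x y) × Strong m₁ × Strong m₂

-- Split structure: inV₂ x = true means x ∈ V₂, false means x ∈ V₁.
IsSplit : ∀ {n} → Multi n → (Fin n → Bool) → Set
IsSplit {n} D inV₂ =
  (∃[ x ] inV₂ x ≡ false) × (∃[ x ] inV₂ x ≡ true) ×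
  (∀ x y → inV₂ x ≡ false → inV₂ y ≡ false → mult D x y ≡ 0) ×
  (∀ x y → inV₂ x ≡ true → inV₂ y ≡ true → x ≢ y →
     (1 ≤ mult D x y) ⊎ (1 ≤ mult D y x))

-- |V₂| ≤ k : V₂ can be listed by a function from Fin k (covering V₂)
V₂size≤ : ∀ {n} → (Fin n → Bool) → ℕ → Set
V₂size≤ {n} inV₂ k = Σ (Fin k → Fin n) λ f → ∀ x → inV₂ x ≡ true → ∃[ i ] f i ≡ x

-- The directed multigraphs S₄, S₄,₁, S₄,₂, S₄,₃ (vertex vᵢ ↦ index i-1)
v1 v2 v3 v4 : Fin 4
v1 = zero
v2 = suc zero
v3 = suc (suc zero)
v4 = suc (suc (suc zero))

S4 : Fin 4 → Fin 4 → ℕ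
S4 zero (suc zero) = 1                          -- v1v2
S4 (suc zero) (suc (suc zero)) = 1              -- v2v3
S4 (suc (suc zero)) (suc (suc (suc zero))) = 1  -- v3v4
S4 (suc (suc (suc zero))) zero = 1              -- v4v1
S4 zero (suc (suc zero)) = 1                    -- v1v3
S4 (suc (suc zero)) zero = 1                    -- v3v1
S4 (suc zero) (suc (suc (suc zero))) = 1        -- v2v4
S4 (suc (suc (suc zero))) (suc zero) = 1        -- v4v2
S4 _ _ = 0

S41 : Fin 4 → Fin 4 → ℕ
S41 (suc (suc zero)) zero = 2                   -- extra v3v1
S41 x y = S4 x y

S42 : Fin 4 → Fin 4 → ℕ
S42 zero (suc zero) = 2                         -- extra v1v2
S42 x y = S4 x y

S43 : Fin 4 → Fin 4 → ℕ
S43 (suc (suc zero)) zero = 2                   -- extra v3v1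
S43 (suc zero) (suc (suc (suc zero))) = 2       -- extra v2v4
S43 x y = S4 x y

InducedIso : ∀ {n} → Multi n → (Fin n → Bool) → (Fin 4 → Fin 4 → ℕ) → Set
InducedIso {n} D inV₂ S =
  Σ (Fin 4 → Fin n) λ f →
    Injective _≡_ _≡_ f ×
    (∀ i → inV₂ (f i) ≡ true) ×
    (∀ x → inV₂ x ≡ true → ∃[ i ] f i ≡ x) ×
    (∀ i j → mult D (f i) (f j) ≡ S i j)

SimpleOutsideV₂ : ∀ {n} → Multi n → (Fin n → Bool) → Set
SimpleOutsideV₂ {n} D inV₂ =
  ∀ x y → (inV₂ x ≡ false ⊎ inV₂ y ≡ false) → mult D x y ≤ 1

-- Each construction colours every ordered pair of vertices red or blue according to the
-- classes of its endpoints (parallel arcs share a colour) and proves both colour classes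
-- strong by walks to and from a hub.
--
-- (ii) Let f enumerate V₂ so that f v1, …, f v4 carry S₄. A vertex x ∈ V₁ has at least three
-- out-neighbours, all simple and all in V₂, so it misses at most one vertex of V₂; likewise
-- for in-neighbours. Red: the Hamiltonian cycle v1v2v3v4v1 of S₄ and, for each x ∈ V₁, one
-- arc from x to V₂ and one from V₂ to x. Blue: the rest. It contains the 2-cycles v1v3 and
-- v2v4, and each x ∈ V₁ keeps blue arcs to and from both of them, so walks through any
-- vertex of V₁ connect the two 2-cycles.
--
-- (i) Out- and in-degree at least 3 into V₂ with |V₂| ≤ 3 force V₂ = {a, b, c} with every
-- x ∈ V₁ joined to a, b, c in both directions. If V₁ contains some x₁ ≠ x₀, red consists of
-- x → a, a → x, x → b, c → x for x ∈ V₁ ∖ {x₀} together with b → x₀ → c. If V₁ = {x₀},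
-- 2-arc-strongness gives every vertex of V₂ an out- and an in-neighbour inside V₂; following
-- out-neighbours yields a Hamiltonian path a → b → c of D⟨V₂⟩. Red is the 4-cycle x₀abcx₀,
-- and blue is strong because c keeps an out-neighbour and a an in-neighbour inside V₂.
--
-- Both degree arguments rest on ∑ g ≤ ∑ (g ∘ f) for a 0/1-valued g whose support is covered
-- by f : Fin k → Fin n.

module Submission where

open import Defs
open import Data.Nat using (ℕ; zero; suc; _+_; _≤_; _∸_; z≤n; s≤s)
open import Data.Nat.Properties
  using (≤-refl; ≤-trans; ≤-reflexive; ≤-antisym; +-mono-≤; +-monoʳ-≤; +-identityʳ; m∸n≤m;
         n≢0⇒n>0; n>0⇒n≢0; 0≢1+n; <-irrefl; ≰⇒>; n<1⇒n≡0; +-commutativeSemigroup;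
         module ≤-Reasoning)
  renaming (_≟_ to _≟ℕ_)
open import Algebra.Properties.CommutativeSemigroup +-commutativeSemigroup using (x∙yz≈y∙xz)
open import Data.Fin using (Fin; zero; suc; _≟_; punchOut)
open import Data.Fin.Properties using (any?; ¬Fin0; punchOut-injective)
open import Data.Bool using (Bool; true; false; T; not; if_then_else_)
import Data.Bool.Properties as Bool
open import Data.List using (tabulate)
open import Data.List.Properties using (map-tabulate)
open import Data.Nat.ListAction using (sum)
open import Data.Maybe using (Maybe; just; nothing; maybe)
open import Data.Product using (∃-syntax; _,_; _×_; proj₁; proj₂)
open import Data.Sum using (_⊎_; inj₁; inj₂)
open import Relation.Nullary using (¬_; yes; no; does; ⌊_⌋; contradiction; ¬?)
open import Relation.Nullary.Decidable using (dec-true; dec-false; fromWitness; fromWitnessFalse; _×-dec_)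
open import Relation.Binary.PropositionalEquality
open import Function using (id; _∘_)
open import Function.Definitions using (Injective)

∑ : ∀ {n} → (Fin n → ℕ) → ℕ
∑ g = sum (tabulate g)

outdeg≡∑ : ∀ {n} (D : Multi n) x → outdeg D x ≡ ∑ (mult D x)
outdeg≡∑ D x = cong sum (map-tabulate id (mult D x))

indeg≡∑ : ∀ {n} (D : Multi n) x → indeg D x ≡ ∑ (λ y → mult D y x)
indeg≡∑ D x = cong sum (map-tabulate id (λ y → mult D y x))

∑-mono : ∀ {n} {g h : Fin n → ℕ} → (∀ i → g i ≤ h i) → ∑ g ≤ ∑ h
∑-mono {zero}  g≤h = z≤n
∑-mono {suc n} g≤h = +-mono-≤ (g≤h zero) (∑-mono (g≤h ∘ suc))

∑-null : ∀ {n} {g : Fin n → ℕ} → (∀ i → g i ≡ 0) → ∑ g ≡ 0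
∑-null {zero}  g≡0 = refl
∑-null {suc n} g≡0 rewrite g≡0 zero = ∑-null (g≡0 ∘ suc)

absorb : ∀ {a s k m} → a ≤ 1 → k + s ≤ m → k + (a + s) ≤ suc m
absorb {a} {s} {k} {m} a≤1 k+s≤m =
  subst (_≤ suc m) (x∙yz≈y∙xz a k s) (+-mono-≤ a≤1 k+s≤m)

∑-≤-size : ∀ {n} {g : Fin n → ℕ} → (∀ i → g i ≤ 1) → ∑ g ≤ n
∑-≤-size {zero}  _   = z≤n
∑-≤-size {suc n} g≤1 = +-mono-≤ (g≤1 zero) (∑-≤-size (g≤1 ∘ suc))

∑-gap : ∀ {n} {g : Fin n → ℕ} → (∀ i → g i ≤ 1) →
        ∀ {i} → g i ≡ 0 → suc (∑ g) ≤ n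
∑-gap {suc n} g≤1 {zero}  gi≡0 rewrite gi≡0 = s≤s (∑-≤-size (g≤1 ∘ suc))
∑-gap {suc n} g≤1 {suc i} gi≡0 = absorb {k = 1} (g≤1 zero) (∑-gap (g≤1 ∘ suc) gi≡0)

∑-two-gaps : ∀ {n} {g : Fin n → ℕ} → (∀ i → g i ≤ 1) →
             ∀ {i j} → i ≢ j → g i ≡ 0 → g j ≡ 0 → 2 + ∑ g ≤ n
∑-two-gaps {suc n} g≤1 {zero}  {zero}  i≢j _ _ = contradiction refl i≢j
∑-two-gaps {suc n} g≤1 {zero}  {suc j} _ gi≡0 gj≡0 rewrite gi≡0 =
  s≤s (∑-gap (g≤1 ∘ suc) gj≡0)
∑-two-gaps {suc n} g≤1 {suc i} {zero}  _ gi≡0 gj≡0 rewrite gj≡0 =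
  s≤s (∑-gap (g≤1 ∘ suc) gi≡0)
∑-two-gaps {suc n} g≤1 {suc i} {suc j} i≢j gi≡0 gj≡0 =
  absorb {k = 2} (g≤1 zero) (∑-two-gaps (g≤1 ∘ suc) (i≢j ∘ cong suc) gi≡0 gj≡0)

_without_ : ∀ {n} → (Fin n → ℕ) → Fin n → Fin n → ℕ
(g without u) y = if does (y ≟ u) then 0 else g y

without-≤ : ∀ {n} (g : Fin n → ℕ) u y → (g without u) y ≤ g y
without-≤ g u y with y ≟ u
... | yes _ = z≤n
... | no  _ = ≤-refl

without-self : ∀ {n} (g : Fin n → ℕ) u → (g without u) u ≡ 0
without-self g u with u ≟ u
... | yes _   = refl
... | no  u≢u = contradiction refl u≢u

without-support : ∀ {n} (g : Fin n → ℕ) u y → 1 ≤ (g without u) y → y ≢ u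
without-support g u y p with y ≟ u
... | no y≢u = y≢u

∑-without : ∀ {n} (g : Fin n → ℕ) u → ∑ g ≡ g u + ∑ (g without u)
∑-without g zero    = refl
∑-without g (suc u) =
  trans (cong (g zero +_) (∑-without (g ∘ suc) u)) (x∙yz≈y∙xz (g zero) (g (suc u)) _)

∑-≤-∑∘ : ∀ {k n} (g : Fin n → ℕ) (f : Fin k → Fin n) →
         (∀ y → 1 ≤ g y → ∃[ t ] f t ≡ y) → ∑ g ≤ ∑ (g ∘ f)
∑-≤-∑∘ {zero} g f covers =
  ≤-reflexive (∑-null λ y → n<1⇒n≡0 (≰⇒> λ 1≤gy → ¬Fin0 (proj₁ (covers y 1≤gy))))
∑-≤-∑∘ {suc k} g f covers = begin
  ∑ g                          ≡⟨ ∑-without g (f zero) ⟩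
  g (f zero) + ∑ g′            ≤⟨ +-monoʳ-≤ (g (f zero)) (∑-≤-∑∘ g′ (f ∘ suc) covers′) ⟩
  g (f zero) + ∑ (g′ ∘ f ∘ suc) ≤⟨ +-monoʳ-≤ (g (f zero)) (∑-mono λ t → without-≤ g (f zero) (f (suc t))) ⟩
  ∑ (g ∘ f)                    ∎
  where
  open ≤-Reasoning
  g′ = g without f zero
  covers′ : ∀ y → 1 ≤ g′ y → ∃[ t ] f (suc t) ≡ y
  covers′ y p with covers y (≤-trans p (without-≤ g (f zero) y))
  ... | zero  , refl = contradiction refl (without-support g (f zero) y p)
  ... | suc t , ft≡y = t , ft≡y

module Support {n k} (g : Fin n → ℕ) (g≤1 : ∀ y → g y ≤ 1)
               (f : Fin k → Fin n) (covers : ∀ y → 1 ≤ g y → ∃[ t ] f t ≡ y) where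
  open ≤-Reasoning

  positive : k ≤ ∑ g → ∀ t → 1 ≤ g (f t)
  positive k≤∑g t = n≢0⇒n>0 λ gft≡0 → <-irrefl refl (begin-strict
    ∑ (g ∘ f) <⟨ ∑-gap (g≤1 ∘ f) gft≡0 ⟩
    k         ≤⟨ k≤∑g ⟩
    ∑ g       ≤⟨ ∑-≤-∑∘ g f covers ⟩
    ∑ (g ∘ f) ∎)

  injective : k ≤ ∑ g → Injective _≡_ _≡_ f
  injective k≤∑g {i} {j} fi≡fj with i ≟ j
  ... | yes i≡j = i≡j
  ... | no  i≢j = contradiction (begin-strict
    k              ≤⟨ k≤∑g ⟩
    ∑ g            ≡⟨ ∑-without g (f i) ⟩
    g (f i) + ∑ g′ ≤⟨ +-mono-≤ (g≤1 (f i)) (∑-≤-∑∘ g′ f g′-covered) ⟩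
    1 + ∑ (g′ ∘ f) <⟨ ∑-two-gaps (g′≤1 ∘ f) i≢j g′fi≡0 (trans (cong g′ (sym fi≡fj)) g′fi≡0) ⟩
    k              ∎) (<-irrefl refl)
    where
    -- removing the point f i = f j leaves gaps at both i and j along f
    g′ = g without f i
    g′≤1 : ∀ y → g′ y ≤ 1
    g′≤1 y = ≤-trans (without-≤ g (f i) y) (g≤1 y)
    g′-covered : ∀ y → 1 ≤ g′ y → ∃[ t ] f t ≡ y
    g′-covered y p = covers y (≤-trans p (without-≤ g (f i) y))
    g′fi≡0 : g′ (f i) ≡ 0
    g′fi≡0 = without-self g (f i)

  gaps-coincide : k ≤ suc (∑ g) → ∀ {i j} → g (f i) ≡ 0 → g (f j) ≡ 0 → i ≡ j
  gaps-coincide k≤1+∑g {i} {j} gfi≡0 gfj≡0 with i ≟ j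
  ... | yes i≡j = i≡j
  ... | no  i≢j = contradiction (begin-strict
    k               ≤⟨ k≤1+∑g ⟩
    suc (∑ g)       ≤⟨ s≤s (∑-≤-∑∘ g f covers) ⟩
    suc (∑ (g ∘ f)) <⟨ ∑-two-gaps (g≤1 ∘ f) i≢j gfi≡0 gfj≡0 ⟩
    k               ∎) (<-irrefl refl)

-- The zero of h if it has one, and zero otherwise.
gap : ∀ {k} → (Fin (suc k) → ℕ) → Fin (suc k)
gap h with any? (λ i → h i ≟ℕ 0)
... | yes (z , _) = z
... | no  _       = zero

gap-spec : ∀ {k} {h : Fin (suc k) → ℕ} → (∀ {i j} → h i ≡ 0 → h j ≡ 0 → i ≡ j) →
           ∀ {i} → i ≢ gap h → 1 ≤ h i
gap-spec {h = h} coincide {i} i≢gap with any? (λ i → h i ≟ℕ 0)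
... | yes (z , hz≡0) = n≢0⇒n>0 λ hi≡0 → i≢gap (coincide hi≡0 hz≡0)
... | no  ∄zero      = n≢0⇒n>0 λ hi≡0 → ∄zero (i , hi≡0)

module _ {n} {m : Fin n → Fin n → ℕ} where

  infixr 5 _▹_
  _▹_ : ∀ {x y z} → Reach m x y → Reach m y z → Reach m x z
  here     ▹ q = q
  step a p ▹ q = step a (p ▹ q)

  arc : ∀ {x y} → 1 ≤ m x y → Reach m x y
  arc a = step a here

  strong-via : (h : Fin n) → (∀ x → Reach m x h) → (∀ y → Reach m h y) → Strong m
  strong-via h to from x y = to x ▹ from y

  first-arc : ∀ {x y} → x ≢ y → Reach m x y → ∃[ z ] 1 ≤ m x z
  first-arc x≢y here = contradiction refl x≢y
  first-arc _ (step {z = z} a _) = z , a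

  last-arc : ∀ {x y} → x ≢ y → Reach m x y → ∃[ z ] 1 ≤ m z y
  last-arc x≢y here = contradiction refl x≢y
  last-arc {x} {y} _ (step {z = z} a p) with z ≟ y
  ... | yes refl = x , a
  ... | no  z≢y  = last-arc z≢y p

deleteArc-≤ : ∀ {n} (m : Fin n → Fin n → ℕ) a b x y → deleteArc m a b x y ≤ m x y
deleteArc-≤ m a b x y with x ≟ a | y ≟ b
... | yes _ | yes _ = m∸n≤m (m x y) 1
... | yes _ | no  _ = ≤-refl
... | no  _ | _     = ≤-refl

deleteArc-self : ∀ {n} (m : Fin n → Fin n → ℕ) a b → deleteArc m a b a b ≡ m a b ∸ 1
deleteArc-self m a b with a ≟ a | b ≟ b
... | yes _ | yes _   = refl
... | yes _ | no  b≢b = contradiction refl b≢b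
... | no  a≢a | _     = contradiction refl a≢a

module TwoArcStrongness {n} (D : Multi n) (two-arc-strong : TwoArcStrong D) {x y : Fin n}
                        (simple : mult D x y ≡ 1) where
  private
    x≢y : x ≢ y
    x≢y refl = 0≢1+n (trans (sym (noLoop D x)) simple)

    survives-deletion : Reach (deleteArc (mult D) x y) x y
    survives-deletion = proj₂ two-arc-strong x y (≤-reflexive (sym simple)) x y

    deleted : ¬ (1 ≤ deleteArc (mult D) x y x y)
    deleted p with () ← subst (1 ≤_) (trans (deleteArc-self (mult D) x y) (cong (_∸ 1) simple)) p

  another-out-neighbour : ∃[ z ] z ≢ y × 1 ≤ mult D x z
  another-out-neighbour with first-arc x≢y survives-deletion
  ... | z , p with y ≟ z
  ...   | yes refl = contradiction p deleted
  ...   | no  y≢z  = z , y≢z ∘ sym , ≤-trans p (deleteArc-≤ (mult D) x y x z)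

  another-in-neighbour : ∃[ z ] z ≢ x × 1 ≤ mult D z y
  another-in-neighbour with last-arc x≢y survives-deletion
  ... | z , p with x ≟ z
  ...   | yes refl = contradiction p deleted
  ...   | no  x≢z  = z , x≢z ∘ sym , ≤-trans p (deleteArc-≤ (mult D) x y z y)

module Colouring {n} (D : Multi n) {C : Set} (class : Fin n → C) (red : C → C → Bool) where

  redArcs blueArcs : Fin n → Fin n → ℕ
  redArcs  x y = if red (class x) (class y) then mult D x y else 0
  blueArcs x y = if red (class x) (class y) then 0 else mult D x y

  Red Blue : Fin n → Fin n → Set
  Red  = Reach redArcs
  Blue = Reach blueArcs

  private
    red-part : ∀ {x y} → T (red (class x) (class y)) → 1 ≤ mult D x y → 1 ≤ redArcs x y
    red-part {x} {y} _ p with red (class x) (class y)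
    ... | true = p

    blue-part : ∀ {x y} → T (not (red (class x) (class y))) → 1 ≤ mult D x y → 1 ≤ blueArcs x y
    blue-part {x} {y} _ p with red (class x) (class y)
    ... | false = p

  red-arc : ∀ {x y c d} → class x ≡ c → class y ≡ d → {_ : T (red c d)} →
            1 ≤ mult D x y → Red x y
  red-arc refl refl {c↦d} p = arc (red-part c↦d p)

  blue-arc : ∀ {x y c d} → class x ≡ c → class y ≡ d → {_ : T (not (red c d))} →
             1 ≤ mult D x y → Blue x y
  blue-arc refl refl {c↛d} p = arc (blue-part c↛d p)

  decomposition : Strong redArcs → Strong blueArcs → HasStrongArcDecomposition D
  decomposition red-strong blue-strong = redArcs , blueArcs , partition , red-strong , blue-strong
    where
    partition : ∀ x y → redArcs x y + blueArcs x y ≡ mult D x y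
    partition x y with red (class x) (class y)
    ... | true  = +-identityʳ (mult D x y)
    ... | false = refl

module Enumeration {n k} (inV₂ : Fin n → Bool) (f : Fin k → Fin n)
                   (f-injective : Injective _≡_ _≡_ f) (f-V₂ : ∀ i → inV₂ (f i) ≡ true)
                   (f-onto : ∀ x → inV₂ x ≡ true → ∃[ i ] f i ≡ x) where

  index : Fin n → Maybe (Fin k)
  index x with any? (λ i → f i ≟ x)
  ... | yes (i , _) = just i
  ... | no  _       = nothing

  index-f : ∀ i → index (f i) ≡ just i
  index-f i with any? (λ j → f j ≟ f i)
  ... | yes (j , fj≡fi) = cong just (f-injective fj≡fi)
  ... | no  ∄j          = contradiction (i , refl) ∄j

  index-V₁ : ∀ {x} → inV₂ x ≡ false → index x ≡ nothing
  index-V₁ {x} x∈V₁ with any? (λ j → f j ≟ x)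
  ... | yes (j , refl) = contradiction (trans (sym (f-V₂ j)) x∈V₁) λ ()
  ... | no  _          = refl

  data Location (x : Fin n) : Set where
    in-V₂ : ∀ i → f i ≡ x → Location x
    in-V₁ : inV₂ x ≡ false → Location x

  locate : ∀ x → Location x
  locate x with inV₂ x in x∈?
  ... | true  = let i , fi≡x = f-onto x x∈? in in-V₂ i fi≡x
  ... | false = in-V₁ x∈?

V₁-Independent : ∀ {n} → Multi n → (Fin n → Bool) → Set
V₁-Independent {n} D inV₂ = ∀ x y → inV₂ x ≡ false → inV₂ y ≡ false → mult D x y ≡ 0

module V₁-Neighbourhoods
  {n k} (D : Multi n) (inV₂ : Fin n → Bool) (independent : V₁-Independent D inV₂)
  (degrees : ∀ x → inV₂ x ≡ false → 3 ≤ outdeg D x × 3 ≤ indeg D x)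
  (simple-out : ∀ {x} → inV₂ x ≡ false → ∀ y → mult D x y ≤ 1)
  (simple-in  : ∀ {x} → inV₂ x ≡ false → ∀ y → mult D y x ≤ 1)
  (f : Fin k → Fin n) (f-onto : ∀ x → inV₂ x ≡ true → ∃[ i ] f i ≡ x)
  where

  out-of-V₁ : ∀ {x y} → inV₂ x ≡ false → 1 ≤ mult D x y → inV₂ y ≡ true
  out-of-V₁ {x} {y} x∈V₁ x→y with inV₂ y in y∈?
  ... | true  = refl
  ... | false = contradiction (independent x y x∈V₁ y∈?) (n>0⇒n≢0 x→y)

  into-V₁ : ∀ {x y} → inV₂ x ≡ false → 1 ≤ mult D y x → inV₂ y ≡ true
  into-V₁ {x} {y} x∈V₁ y→x with inV₂ y in y∈?
  ... | true  = refl
  ... | false = contradiction (independent y x y∈? x∈V₁) (n>0⇒n≢0 y→x)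

  module Out {x} (x∈V₁ : inV₂ x ≡ false) =
    Support (mult D x) (simple-out x∈V₁) f (λ y x→y → f-onto y (out-of-V₁ x∈V₁ x→y))

  module In {x} (x∈V₁ : inV₂ x ≡ false) =
    Support (λ y → mult D y x) (simple-in x∈V₁) f (λ y y→x → f-onto y (into-V₁ x∈V₁ y→x))

  out-size : ∀ {x} → inV₂ x ≡ false → 3 ≤ ∑ (mult D x)
  out-size {x} x∈V₁ = subst (3 ≤_) (outdeg≡∑ D x) (proj₁ (degrees x x∈V₁))

  in-size : ∀ {x} → inV₂ x ≡ false → 3 ≤ ∑ (λ y → mult D y x)
  in-size {x} x∈V₁ = subst (3 ≤_) (indeg≡∑ D x) (proj₂ (degrees x x∈V₁))

Fin3-exhaustive : ∀ {a b c : Fin 3} → a ≢ b → a ≢ c → b ≢ c → ∀ t → t ≡ a ⊎ t ≡ b ⊎ t ≡ c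
Fin3-exhaustive {a} {b} {c} a≢b a≢c b≢c t with t ≟ a | t ≟ b | t ≟ c
... | yes t≡a | _       | _       = inj₁ t≡a
... | no  _   | yes t≡b | _       = inj₂ (inj₁ t≡b)
... | no  _   | no  _   | yes t≡c = inj₂ (inj₂ t≡c)
... | no  t≢a | no  t≢b | no  t≢c = contradiction c≡t (≢-sym t≢c)
  where
  -- Removing a leaves b, c and t pairwise distinct in Fin 2; removing b's image leaves
  -- the images of c and t in Fin 1, where they coincide.
  a≢t = ≢-sym t≢a
  b′≢c′ : punchOut a≢b ≢ punchOut a≢c
  b′≢c′ = b≢c ∘ punchOut-injective a≢b a≢c
  b′≢t′ : punchOut a≢b ≢ punchOut a≢t
  b′≢t′ = ≢-sym t≢b ∘ punchOut-injective a≢b a≢t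
  Fin1-unique : (i j : Fin 1) → i ≡ j
  Fin1-unique zero zero = refl
  c≡t : c ≡ t
  c≡t = punchOut-injective a≢c a≢t
          (punchOut-injective b′≢c′ b′≢t′ (Fin1-unique (punchOut b′≢c′) (punchOut b′≢t′)))

≡-≢-trans : ∀ {A : Set} {x y z : A} → x ≡ y → y ≢ z → x ≢ z
≡-≢-trans x≡y y≢z = y≢z ∘ trans (sym x≡y)

square-moves : (o : Fin 3 → Fin 3) → (∀ i → o i ≢ i) → ∃[ k ] o (o k) ≢ k
square-moves o moves with o zero in e₀ | o (suc zero) in e₁ | o (suc (suc zero)) in e₂
... | zero           | _              | _              = contradiction e₀ (moves _)
... | _              | suc zero       | _              = contradiction e₁ (moves _)
... | _              | _              | suc (suc zero) = contradiction e₂ (moves _)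
... | suc zero       | suc (suc zero) | _              = zero , ≡-≢-trans (trans (cong o e₀) e₁) λ ()
... | suc zero       | zero           | zero           = suc (suc zero) , ≡-≢-trans (trans (cong o e₂) e₀) λ ()
... | suc zero       | zero           | suc zero       = suc (suc zero) , ≡-≢-trans (trans (cong o e₂) e₁) λ ()
... | suc (suc zero) | _              | suc zero       = zero , ≡-≢-trans (trans (cong o e₀) e₂) λ ()
... | suc (suc zero) | zero           | zero           = suc zero , ≡-≢-trans (trans (cong o e₁) e₀) λ ()
... | suc (suc zero) | suc (suc zero) | zero           = suc zero , ≡-≢-trans (trans (cong o e₁) e₂) λ ()

next : Fin 4 → Fin 4
next zero                   = suc zero
next (suc zero)             = suc (suc zero)
next (suc (suc zero))       = suc (suc (suc zero))
next (suc (suc (suc zero))) = zero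

S4-cycle : ∀ i → 1 ≤ S4 i (next i)
S4-cycle zero                   = s≤s z≤n
S4-cycle (suc zero)             = s≤s z≤n
S4-cycle (suc (suc zero))       = s≤s z≤n
S4-cycle (suc (suc (suc zero))) = s≤s z≤n

data Even : Fin 4 → Set where
  even₁ : Even v1
  even₃ : Even v3

data Odd : Fin 4 → Set where
  odd₂ : Odd v2
  odd₄ : Odd v4

parity : ∀ i → Even i ⊎ Odd i
parity zero                   = inj₁ even₁
parity (suc zero)             = inj₂ odd₂
parity (suc (suc zero))       = inj₁ even₃
parity (suc (suc (suc zero))) = inj₂ odd₄

-- Avoiding the vertex z that x ∈ V₁ misses: spare carries the red arc at x, and even and
-- odd carry blue arcs into the 2-cycles v1v3 and v2v4 of S4.
record Transversal (z : Fin 4) : Set where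
  field
    spare even odd : Fin 4
    even-is-even   : Even even
    odd-is-odd     : Odd odd
    even≢spare     : even ≢ spare
    odd≢spare      : odd ≢ spare
    spare≢z        : spare ≢ z
    even≢z         : even ≢ z
    odd≢z          : odd ≢ z

transversal : ∀ z → Transversal z
transversal zero = record
  { spare = v4 ; even = v3 ; odd = v2 ; even-is-even = even₃ ; odd-is-odd = odd₂
  ; even≢spare = λ () ; odd≢spare = λ () ; spare≢z = λ () ; even≢z = λ () ; odd≢z = λ () }
transversal (suc zero) = record
  { spare = v3 ; even = v1 ; odd = v4 ; even-is-even = even₁ ; odd-is-odd = odd₄
  ; even≢spare = λ () ; odd≢spare = λ () ; spare≢z = λ () ; even≢z = λ () ; odd≢z = λ () }
transversal (suc (suc zero)) = record
  { spare = v4 ; even = v1 ; odd = v2 ; even-is-even = even₁ ; odd-is-odd = odd₂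
  ; even≢spare = λ () ; odd≢spare = λ () ; spare≢z = λ () ; even≢z = λ () ; odd≢z = λ () }
transversal (suc (suc (suc zero))) = record
  { spare = v3 ; even = v1 ; odd = v2 ; even-is-even = even₁ ; odd-is-odd = odd₂
  ; even≢spare = λ () ; odd≢spare = λ () ; spare≢z = λ () ; even≢z = λ () ; odd≢z = λ () }

open Transversal

-- A vertex of V₁ is classified by the vertices of V₂ it may miss as out- and as in-neighbour.
data Class-S4 : Set where
  vertex  : Fin 4 → Class-S4
  outside : (out-gap in-gap : Fin 4) → Class-S4

red-S4 : Class-S4 → Class-S4 → Bool
red-S4 (vertex i)    (vertex j)    = ⌊ j ≟ next i ⌋
red-S4 (outside z _) (vertex j)    = ⌊ j ≟ spare (transversal z) ⌋
red-S4 (vertex i)    (outside _ z) = ⌊ i ≟ spare (transversal z) ⌋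
red-S4 (outside _ _) (outside _ _) = false

module Spanning-S4
  {n} (D : Multi n) (inV₂ : Fin n → Bool)
  (f : Fin 4 → Fin n) (f-injective : Injective _≡_ _≡_ f)
  (f-V₂ : ∀ i → inV₂ (f i) ≡ true) (f-onto : ∀ x → inV₂ x ≡ true → ∃[ i ] f i ≡ x)
  (S4⊆D : ∀ i j → S4 i j ≤ mult D (f i) (f j))
  (out-gaps-coincide : ∀ {x} → inV₂ x ≡ false →
     ∀ {i j} → mult D x (f i) ≡ 0 → mult D x (f j) ≡ 0 → i ≡ j)
  (in-gaps-coincide : ∀ {x} → inV₂ x ≡ false →
     ∀ {i j} → mult D (f i) x ≡ 0 → mult D (f j) x ≡ 0 → i ≡ j)
  {x₀ : Fin n} (x₀∈V₁ : inV₂ x₀ ≡ false)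
  where

  open Enumeration inV₂ f f-injective f-V₂ f-onto

  out-gap in-gap : Fin n → Fin 4
  out-gap x = gap (λ i → mult D x (f i))
  in-gap  x = gap (λ i → mult D (f i) x)

  class : Fin n → Class-S4
  class x = maybe vertex (outside (out-gap x) (in-gap x)) (index x)

  open Colouring D class red-S4

  class-f : ∀ i → class (f i) ≡ vertex i
  class-f i = cong (maybe vertex _) (index-f i)

  class-V₁ : ∀ {x} → inV₂ x ≡ false → class x ≡ outside (out-gap x) (in-gap x)
  class-V₁ x∈V₁ = cong (maybe vertex _) (index-V₁ x∈V₁)

  T⁺ : ∀ x → Transversal (out-gap x)
  T⁺ x = transversal (out-gap x)

  T⁻ : ∀ x → Transversal (in-gap x)
  T⁻ x = transversal (in-gap x)

  module _ {x} (x∈V₁ : inV₂ x ≡ false) where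
    private
      out-arc : ∀ {i} → i ≢ out-gap x → 1 ≤ mult D x (f i)
      out-arc = gap-spec (out-gaps-coincide x∈V₁)

      in-arc : ∀ {i} → i ≢ in-gap x → 1 ≤ mult D (f i) x
      in-arc = gap-spec (in-gaps-coincide x∈V₁)

    red-out : Red x (f (spare (T⁺ x)))
    red-out = red-arc (class-V₁ x∈V₁) (class-f _) {fromWitness refl} (out-arc (spare≢z (T⁺ x)))

    red-in : Red (f (spare (T⁻ x))) x
    red-in = red-arc (class-f _) (class-V₁ x∈V₁) {fromWitness refl} (in-arc (spare≢z (T⁻ x)))

    blue-out-even : Blue x (f (even (T⁺ x)))
    blue-out-even = blue-arc (class-V₁ x∈V₁) (class-f _)
      {fromWitnessFalse (even≢spare (T⁺ x))} (out-arc (even≢z (T⁺ x)))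

    blue-out-odd : Blue x (f (odd (T⁺ x)))
    blue-out-odd = blue-arc (class-V₁ x∈V₁) (class-f _)
      {fromWitnessFalse (odd≢spare (T⁺ x))} (out-arc (odd≢z (T⁺ x)))

    blue-in-even : Blue (f (even (T⁻ x))) x
    blue-in-even = blue-arc (class-f _) (class-V₁ x∈V₁)
      {fromWitnessFalse (even≢spare (T⁻ x))} (in-arc (even≢z (T⁻ x)))

    blue-in-odd : Blue (f (odd (T⁻ x))) x
    blue-in-odd = blue-arc (class-f _) (class-V₁ x∈V₁)
      {fromWitnessFalse (odd≢spare (T⁻ x))} (in-arc (odd≢z (T⁻ x)))

  red-cycle : ∀ i → Red (f i) (f (next i))
  red-cycle i = red-arc (class-f i) (class-f (next i)) {fromWitness refl}
    (≤-trans (S4-cycle i) (S4⊆D i (next i)))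

  red-to-v1 : ∀ i → Red (f i) (f v1)
  red-to-v1 zero                   = here
  red-to-v1 (suc zero)             = red-cycle v2 ▹ red-cycle v3 ▹ red-cycle v4
  red-to-v1 (suc (suc zero))       = red-cycle v3 ▹ red-cycle v4
  red-to-v1 (suc (suc (suc zero))) = red-cycle v4

  red-from-v1 : ∀ i → Red (f v1) (f i)
  red-from-v1 zero                   = here
  red-from-v1 (suc zero)             = red-cycle v1
  red-from-v1 (suc (suc zero))       = red-cycle v1 ▹ red-cycle v2
  red-from-v1 (suc (suc (suc zero))) = red-cycle v1 ▹ red-cycle v2 ▹ red-cycle v3

  within-even : ∀ {i j} → Even i → Even j → Blue (f i) (f j)
  within-even even₁ even₁ = here
  within-even even₁ even₃ = blue-arc (class-f v1) (class-f v3) (S4⊆D v1 v3)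
  within-even even₃ even₁ = blue-arc (class-f v3) (class-f v1) (S4⊆D v3 v1)
  within-even even₃ even₃ = here

  within-odd : ∀ {i j} → Odd i → Odd j → Blue (f i) (f j)
  within-odd odd₂ odd₂ = here
  within-odd odd₂ odd₄ = blue-arc (class-f v2) (class-f v4) (S4⊆D v2 v4)
  within-odd odd₄ odd₂ = blue-arc (class-f v4) (class-f v2) (S4⊆D v4 v2)
  within-odd odd₄ odd₄ = here

  blue-to-x₀ : ∀ i → Blue (f i) x₀
  blue-to-x₀ i with parity i
  ... | inj₁ i-even = within-even i-even (even-is-even (T⁻ x₀)) ▹ blue-in-even x₀∈V₁
  ... | inj₂ i-odd  = within-odd  i-odd  (odd-is-odd  (T⁻ x₀)) ▹ blue-in-odd  x₀∈V₁

  blue-from-x₀ : ∀ i → Blue x₀ (f i)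
  blue-from-x₀ i with parity i
  ... | inj₁ i-even = blue-out-even x₀∈V₁ ▹ within-even (even-is-even (T⁺ x₀)) i-even
  ... | inj₂ i-odd  = blue-out-odd  x₀∈V₁ ▹ within-odd  (odd-is-odd  (T⁺ x₀)) i-odd

  strong-arc-decomposition : HasStrongArcDecomposition D
  strong-arc-decomposition = decomposition
    (strong-via (f v1) red-to red-from) (strong-via x₀ blue-to blue-from)
    where
    red-to : ∀ x → Red x (f v1)
    red-to x with locate x
    ... | in-V₂ i refl = red-to-v1 i
    ... | in-V₁ x∈V₁   = red-out x∈V₁ ▹ red-to-v1 _

    red-from : ∀ x → Red (f v1) x
    red-from x with locate x
    ... | in-V₂ i refl = red-from-v1 i
    ... | in-V₁ x∈V₁   = red-from-v1 _ ▹ red-in x∈V₁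

    blue-to : ∀ x → Blue x x₀
    blue-to x with locate x
    ... | in-V₂ i refl = blue-to-x₀ i
    ... | in-V₁ x∈V₁   = blue-out-even x∈V₁ ▹ blue-to-x₀ _

    blue-from : ∀ x → Blue x₀ x
    blue-from x with locate x
    ... | in-V₂ i refl = blue-from-x₀ i
    ... | in-V₁ x∈V₁   = blue-from-x₀ _ ▹ blue-in-even x∈V₁

data Class-1a : Set where
  first second third centre other : Class-1a

position-1a : Fin 3 → Class-1a
position-1a zero             = first
position-1a (suc zero)       = second
position-1a (suc (suc zero)) = third

red-1a : Class-1a → Class-1a → Bool
red-1a other  first  = true
red-1a first  other  = true
red-1a other  second = true
red-1a third  other  = true
red-1a second centre = true
red-1a centre third  = true
red-1a _      _      = false

module Joined-To-Triangle
  {n} (D : Multi n) (inV₂ : Fin n → Bool)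
  (f : Fin 3 → Fin n) (f-injective : Injective _≡_ _≡_ f)
  (f-V₂ : ∀ i → inV₂ (f i) ≡ true) (f-onto : ∀ x → inV₂ x ≡ true → ∃[ i ] f i ≡ x)
  (out-arc : ∀ {x} → inV₂ x ≡ false → ∀ i → 1 ≤ mult D x (f i))
  (in-arc  : ∀ {x} → inV₂ x ≡ false → ∀ i → 1 ≤ mult D (f i) x)
  {x₀ x₁ : Fin n} (x₀∈V₁ : inV₂ x₀ ≡ false) (x₁∈V₁ : inV₂ x₁ ≡ false) (x₁≢x₀ : x₁ ≢ x₀)
  where

  open Enumeration inV₂ f f-injective f-V₂ f-onto

  class : Fin n → Class-1a
  class x = maybe position-1a (if does (x ≟ x₀) then centre else other) (index x)

  open Colouring D class red-1a

  record V₁-Vertex (r : Class-1a) : Set where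
    constructor _⟨_,_⟩
    field
      point    : Fin n
      point∈V₁ : inV₂ point ≡ false
      classified : class point ≡ r
  open V₁-Vertex

  class-f : ∀ i → class (f i) ≡ position-1a i
  class-f i = cong (maybe position-1a _) (index-f i)

  ẋ₀ : V₁-Vertex centre
  ẋ₀ = x₀ ⟨ x₀∈V₁ , class-x₀ ⟩
    where
    class-x₀ : class x₀ ≡ centre
    class-x₀ rewrite index-V₁ x₀∈V₁ | dec-true (x₀ ≟ x₀) refl = refl

  as-other : ∀ {x} → inV₂ x ≡ false → x ≢ x₀ → V₁-Vertex other
  as-other {x} x∈V₁ x≢x₀ = x ⟨ x∈V₁ , class-other ⟩
    where
    class-other : class x ≡ other
    class-other rewrite index-V₁ x∈V₁ | dec-false (x ≟ x₀) x≢x₀ = refl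

  ẋ₁ : V₁-Vertex other
  ẋ₁ = as-other x₁∈V₁ x₁≢x₀

  module _ {r} (x : V₁-Vertex r) (i : Fin 3) where
    red→ : {_ : T (red-1a r (position-1a i))} → Red (point x) (f i)
    red→ {r↦i} = red-arc (classified x) (class-f i) {r↦i} (out-arc (point∈V₁ x) i)

    red← : {_ : T (red-1a (position-1a i) r)} → Red (f i) (point x)
    red← {i↦r} = red-arc (class-f i) (classified x) {i↦r} (in-arc (point∈V₁ x) i)

    blue→ : {_ : T (not (red-1a r (position-1a i)))} → Blue (point x) (f i)
    blue→ {r↛i} = blue-arc (classified x) (class-f i) {r↛i} (out-arc (point∈V₁ x) i)

    blue← : {_ : T (not (red-1a (position-1a i) r))} → Blue (f i) (point x)
    blue← {i↛r} = blue-arc (class-f i) (classified x) {i↛r} (in-arc (point∈V₁ x) i)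

  i₀ i₁ i₂ : Fin 3
  i₀ = zero
  i₁ = suc zero
  i₂ = suc (suc zero)

  third⇝first : Red (f i₂) (f i₀)
  third⇝first = red← ẋ₁ i₂ ▹ red→ ẋ₁ i₀

  first⇝second : Red (f i₀) (f i₁)
  first⇝second = red← ẋ₁ i₀ ▹ red→ ẋ₁ i₁

  second⇝third : Blue (f i₁) (f i₂)
  second⇝third = blue← ẋ₁ i₁ ▹ blue→ ẋ₁ i₂

  red-to : ∀ x → Red x (f i₀)
  red-to x with locate x
  ... | in-V₂ zero             refl = here
  ... | in-V₂ (suc zero)       refl = red← ẋ₀ i₁ ▹ red→ ẋ₀ i₂ ▹ third⇝first
  ... | in-V₂ (suc (suc zero)) refl = third⇝first
  ... | in-V₁ x∈V₁ with x ≟ x₀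
  ...   | yes refl = red→ ẋ₀ i₂ ▹ third⇝first
  ...   | no  x≢x₀ = red→ (as-other x∈V₁ x≢x₀) i₀

  red-from : ∀ x → Red (f i₀) x
  red-from x with locate x
  ... | in-V₂ zero             refl = here
  ... | in-V₂ (suc zero)       refl = first⇝second
  ... | in-V₂ (suc (suc zero)) refl = first⇝second ▹ red← ẋ₀ i₁ ▹ red→ ẋ₀ i₂
  ... | in-V₁ x∈V₁ with x ≟ x₀
  ...   | yes refl = first⇝second ▹ red← ẋ₀ i₁
  ...   | no  x≢x₀ = red← (as-other x∈V₁ x≢x₀) i₀

  blue-to : ∀ x → Blue x x₀
  blue-to x with locate x
  ... | in-V₂ zero             refl = blue← ẋ₀ i₀
  ... | in-V₂ (suc zero)       refl = second⇝third ▹ blue← ẋ₀ i₂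
  ... | in-V₂ (suc (suc zero)) refl = blue← ẋ₀ i₂
  ... | in-V₁ x∈V₁ with x ≟ x₀
  ...   | yes refl = here
  ...   | no  x≢x₀ = blue→ (as-other x∈V₁ x≢x₀) i₂ ▹ blue← ẋ₀ i₂

  blue-from : ∀ x → Blue x₀ x
  blue-from x with locate x
  ... | in-V₂ zero             refl = blue→ ẋ₀ i₀
  ... | in-V₂ (suc zero)       refl = blue→ ẋ₀ i₁
  ... | in-V₂ (suc (suc zero)) refl = blue→ ẋ₀ i₁ ▹ second⇝third
  ... | in-V₁ x∈V₁ with x ≟ x₀
  ...   | yes refl = here
  ...   | no  x≢x₀ = blue→ ẋ₀ i₁ ▹ blue← (as-other x∈V₁ x≢x₀) i₁

  strong-arc-decomposition : HasStrongArcDecomposition D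
  strong-arc-decomposition =
    decomposition (strong-via (f i₀) red-to red-from) (strong-via x₀ blue-to blue-from)

data Class-1b : Set where
  start middle end centre : Class-1b

red-1b : Class-1b → Class-1b → Bool
red-1b centre start  = true
red-1b start  middle = true
red-1b middle end    = true
red-1b end    centre = true
red-1b _      _      = false

module Single-V₁-Vertex
  {n} (D : Multi n) (inV₂ : Fin n → Bool)
  (f : Fin 3 → Fin n) (f-injective : Injective _≡_ _≡_ f)
  (f-V₂ : ∀ i → inV₂ (f i) ≡ true) (f-onto : ∀ x → inV₂ x ≡ true → ∃[ i ] f i ≡ x)
  {x₀ : Fin n} (x₀∈V₁ : inV₂ x₀ ≡ false) (V₁≡x₀ : ∀ {x} → inV₂ x ≡ false → x ≡ x₀)
  (out-arc : ∀ i → 1 ≤ mult D x₀ (f i)) (in-arc : ∀ i → 1 ≤ mult D (f i) x₀)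
  {a b c : Fin 3} (a≢b : a ≢ b) (a≢c : a ≢ c) (b≢c : b ≢ c)
  (a→b : 1 ≤ mult D (f a) (f b)) (b→c : 1 ≤ mult D (f b) (f c))
  (c-out : ∃[ t ] t ≢ c × 1 ≤ mult D (f c) (f t))
  (a-in  : ∃[ t ] t ≢ a × 1 ≤ mult D (f t) (f a))
  where

  open Enumeration inV₂ f f-injective f-V₂ f-onto

  position : Fin 3 → Class-1b
  position t = if does (t ≟ a) then start else if does (t ≟ b) then middle else end

  class : Fin n → Class-1b
  class x = maybe position centre (index x)

  open Colouring D class red-1b

  class-x₀ : class x₀ ≡ centre
  class-x₀ = cong (maybe position centre) (index-V₁ x₀∈V₁)

  class-a : class (f a) ≡ start
  class-a rewrite index-f a | dec-true (a ≟ a) refl = refl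

  class-b : class (f b) ≡ middle
  class-b rewrite index-f b | dec-false (b ≟ a) (≢-sym a≢b) | dec-true (b ≟ b) refl = refl

  class-c : class (f c) ≡ end
  class-c rewrite index-f c | dec-false (c ≟ a) (≢-sym a≢c) | dec-false (c ≟ b) (≢-sym b≢c) = refl

  exhaustive : ∀ t → t ≡ a ⊎ t ≡ b ⊎ t ≡ c
  exhaustive = Fin3-exhaustive a≢b a≢c b≢c

  x₀⇝a : Red x₀ (f a)
  x₀⇝a = red-arc class-x₀ class-a (out-arc a)

  a⇝b : Red (f a) (f b)
  a⇝b = red-arc class-a class-b a→b

  b⇝c : Red (f b) (f c)
  b⇝c = red-arc class-b class-c b→c

  c⇝x₀ : Red (f c) x₀
  c⇝x₀ = red-arc class-c class-x₀ (in-arc c)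

  a→x₀ : Blue (f a) x₀
  a→x₀ = blue-arc class-a class-x₀ (in-arc a)

  b→x₀ : Blue (f b) x₀
  b→x₀ = blue-arc class-b class-x₀ (in-arc b)

  x₀→b : Blue x₀ (f b)
  x₀→b = blue-arc class-x₀ class-b (out-arc b)

  x₀→c : Blue x₀ (f c)
  x₀→c = blue-arc class-x₀ class-c (out-arc c)

  c-escapes : Blue (f c) x₀
  c-escapes = escape c-out
    where
    escape : ∃[ t ] t ≢ c × 1 ≤ mult D (f c) (f t) → Blue (f c) x₀
    escape (t , t≢c , c→t) with exhaustive t
    ... | inj₁ refl        = blue-arc class-c class-a c→t ▹ a→x₀
    ... | inj₂ (inj₁ refl) = blue-arc class-c class-b c→t ▹ b→x₀
    ... | inj₂ (inj₂ refl) = contradiction refl t≢c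

  a-entered : Blue x₀ (f a)
  a-entered = enter a-in
    where
    enter : ∃[ t ] t ≢ a × 1 ≤ mult D (f t) (f a) → Blue x₀ (f a)
    enter (t , t≢a , t→a) with exhaustive t
    ... | inj₁ refl        = contradiction refl t≢a
    ... | inj₂ (inj₁ refl) = x₀→b ▹ blue-arc class-b class-a t→a
    ... | inj₂ (inj₂ refl) = x₀→c ▹ blue-arc class-c class-a t→a

  red-to : ∀ x → Red x x₀
  red-to x with locate x
  ... | in-V₁ x∈V₁ with refl ← V₁≡x₀ x∈V₁ = here
  ... | in-V₂ t refl with exhaustive t
  ...   | inj₁ refl        = a⇝b ▹ b⇝c ▹ c⇝x₀
  ...   | inj₂ (inj₁ refl) = b⇝c ▹ c⇝x₀
  ...   | inj₂ (inj₂ refl) = c⇝x₀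

  red-from : ∀ x → Red x₀ x
  red-from x with locate x
  ... | in-V₁ x∈V₁ with refl ← V₁≡x₀ x∈V₁ = here
  ... | in-V₂ t refl with exhaustive t
  ...   | inj₁ refl        = x₀⇝a
  ...   | inj₂ (inj₁ refl) = x₀⇝a ▹ a⇝b
  ...   | inj₂ (inj₂ refl) = x₀⇝a ▹ a⇝b ▹ b⇝c

  blue-to : ∀ x → Blue x x₀
  blue-to x with locate x
  ... | in-V₁ x∈V₁ with refl ← V₁≡x₀ x∈V₁ = here
  ... | in-V₂ t refl with exhaustive t
  ...   | inj₁ refl        = a→x₀
  ...   | inj₂ (inj₁ refl) = b→x₀
  ...   | inj₂ (inj₂ refl) = c-escapes

  blue-from : ∀ x → Blue x₀ x
  blue-from x with locate x
  ... | in-V₁ x∈V₁ with refl ← V₁≡x₀ x∈V₁ = here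
  ... | in-V₂ t refl with exhaustive t
  ...   | inj₁ refl        = a-entered
  ...   | inj₂ (inj₁ refl) = x₀→b
  ...   | inj₂ (inj₂ refl) = x₀→c

  strong-arc-decomposition : HasStrongArcDecomposition D
  strong-arc-decomposition =
    decomposition (strong-via x₀ red-to red-from) (strong-via x₀ blue-to blue-from)

module Small-V₂
  {n} (D : Multi n) (inV₂ : Fin n → Bool) (independent : V₁-Independent D inV₂)
  (degrees : ∀ x → inV₂ x ≡ false → 3 ≤ outdeg D x × 3 ≤ indeg D x)
  (digraph : IsDigraph D) (two-arc-strong : TwoArcStrong D)
  {x₀ : Fin n} (x₀∈V₁ : inV₂ x₀ ≡ false)
  (f : Fin 3 → Fin n) (f-onto : ∀ x → inV₂ x ≡ true → ∃[ i ] f i ≡ x)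
  where

  open V₁-Neighbourhoods D inV₂ independent degrees
    (λ {x} _ y → digraph x y) (λ {x} _ y → digraph y x) f f-onto

  out-arc : ∀ {x} → inV₂ x ≡ false → ∀ i → 1 ≤ mult D x (f i)
  out-arc x∈V₁ = Out.positive x∈V₁ (out-size x∈V₁)

  in-arc : ∀ {x} → inV₂ x ≡ false → ∀ i → 1 ≤ mult D (f i) x
  in-arc x∈V₁ = In.positive x∈V₁ (in-size x∈V₁)

  f-injective : Injective _≡_ _≡_ f
  f-injective = Out.injective x₀∈V₁ (out-size x₀∈V₁)

  f-V₂ : ∀ i → inV₂ (f i) ≡ true
  f-V₂ i = out-of-V₁ x₀∈V₁ (out-arc x₀∈V₁ i)

  module V₁-Singleton (V₁≡x₀ : ∀ {x} → inV₂ x ≡ false → x ≡ x₀) where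

    index-of : ∀ {z} → z ≢ x₀ → ∃[ t ] f t ≡ z
    index-of {z} z≢x₀ with inV₂ z in z∈?
    ... | true  = f-onto z z∈?
    ... | false = contradiction (V₁≡x₀ z∈?) z≢x₀

    loopless : ∀ {t s} → 1 ≤ mult D (f t) (f s) → t ≢ s
    loopless {t} t→t refl = n>0⇒n≢0 t→t (noLoop D (f t))

    successor : ∀ i → ∃[ t ] t ≢ i × 1 ≤ mult D (f i) (f t)
    successor i with TwoArcStrongness.another-out-neighbour D two-arc-strong
                       (≤-antisym (digraph _ _) (in-arc x₀∈V₁ i))
    ... | z , z≢x₀ , i→z with index-of z≢x₀
    ...   | t , refl = t , ≢-sym (loopless i→z) , i→z

    predecessor : ∀ i → ∃[ t ] t ≢ i × 1 ≤ mult D (f t) (f i)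
    predecessor i with TwoArcStrongness.another-in-neighbour D two-arc-strong
                         (≤-antisym (digraph _ _) (out-arc x₀∈V₁ i))
    ... | z , z≢x₀ , z→i with index-of z≢x₀
    ...   | t , refl = t , loopless z→i , z→i

    strong-arc-decomposition : HasStrongArcDecomposition D
    strong-arc-decomposition = along (square-moves o moves)
      where
      o : Fin 3 → Fin 3
      o i = proj₁ (successor i)
      moves : ∀ i → o i ≢ i
      moves i = proj₁ (proj₂ (successor i))
      -- following out-neighbours from k gives the Hamiltonian path k → o k → o (o k)
      along : ∃[ k ] o (o k) ≢ k → HasStrongArcDecomposition D
      along (k , o²k≢k) =
        Single-V₁-Vertex.strong-arc-decomposition D inV₂ f f-injective f-V₂ f-onto x₀∈V₁ V₁≡x₀
          (out-arc x₀∈V₁) (in-arc x₀∈V₁) {a = k} {b = o k} {c = o (o k)}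
          (≢-sym (moves k)) (≢-sym o²k≢k) (≢-sym (moves (o k)))
          (proj₂ (proj₂ (successor k))) (proj₂ (proj₂ (successor (o k))))
          (successor (o (o k))) (predecessor k)

  strong-arc-decomposition : HasStrongArcDecomposition D
  strong-arc-decomposition with any? (λ x → (inV₂ x Bool.≟ false) ×-dec ¬? (x ≟ x₀))
  ... | yes (x₁ , x₁∈V₁ , x₁≢x₀) =
    Joined-To-Triangle.strong-arc-decomposition D inV₂ f f-injective f-V₂ f-onto out-arc in-arc
      x₀∈V₁ x₁∈V₁ x₁≢x₀
  ... | no ∄x₁ = V₁-Singleton.strong-arc-decomposition V₁≡x₀
    where
    V₁≡x₀ : ∀ {x} → inV₂ x ≡ false → x ≡ x₀
    V₁≡x₀ {x} x∈V₁ with x ≟ x₀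
    ... | yes x≡x₀ = x≡x₀
    ... | no  x≢x₀ = contradiction (x , x∈V₁ , x≢x₀) ∄x₁

S4≤S41 : ∀ i j → S4 i j ≤ S41 i j
S4≤S41 (suc (suc zero))       zero    = s≤s z≤n
S4≤S41 zero                   _       = ≤-refl
S4≤S41 (suc zero)             _       = ≤-refl
S4≤S41 (suc (suc zero))       (suc _) = ≤-refl
S4≤S41 (suc (suc (suc zero))) _       = ≤-refl

S4≤S42 : ∀ i j → S4 i j ≤ S42 i j
S4≤S42 zero    (suc zero)       = s≤s z≤n
S4≤S42 zero    zero             = ≤-refl
S4≤S42 zero    (suc (suc _))    = ≤-refl
S4≤S42 (suc _) _                = ≤-refl

S4≤S43 : ∀ i j → S4 i j ≤ S43 i j
S4≤S43 (suc (suc zero))       zero                   = s≤s z≤n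
S4≤S43 (suc zero)             (suc (suc (suc zero))) = s≤s z≤n
S4≤S43 zero                   _                      = ≤-refl
S4≤S43 (suc zero)             zero                   = ≤-refl
S4≤S43 (suc zero)             (suc zero)             = ≤-refl
S4≤S43 (suc zero)             (suc (suc zero))       = ≤-refl
S4≤S43 (suc (suc zero))       (suc _)                = ≤-refl
S4≤S43 (suc (suc (suc zero))) _                      = ≤-refl

module Containing-S4
  {n} (D : Multi n) (inV₂ : Fin n → Bool) (independent : V₁-Independent D inV₂)
  (degrees : ∀ x → inV₂ x ≡ false → 3 ≤ outdeg D x × 3 ≤ indeg D x)
  (simple : SimpleOutsideV₂ D inV₂)
  {x₀ : Fin n} (x₀∈V₁ : inV₂ x₀ ≡ false)
  where

  S4-spanned : ∀ {S} → (∀ i j → S4 i j ≤ S i j) → InducedIso D inV₂ S →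
               HasStrongArcDecomposition D
  S4-spanned S4≤S (f , f-injective , f-V₂ , f-onto , f-iso) =
    Spanning-S4.strong-arc-decomposition D inV₂ f f-injective f-V₂ f-onto S4⊆D
      (λ x∈V₁ → Out.gaps-coincide x∈V₁ (s≤s (out-size x∈V₁)))
      (λ x∈V₁ → In.gaps-coincide x∈V₁ (s≤s (in-size x∈V₁)))
      x₀∈V₁
    where
    open V₁-Neighbourhoods D inV₂ independent degrees
      (λ x∈V₁ y → simple _ y (inj₁ x∈V₁)) (λ x∈V₁ y → simple y _ (inj₂ x∈V₁)) f f-onto
    S4⊆D : ∀ i j → S4 i j ≤ mult D (f i) (f j)
    S4⊆D i j = subst (S4 i j ≤_) (sym (f-iso i j)) (S4≤S i j)

  strong-arc-decomposition :
    InducedIso D inV₂ S4 ⊎ InducedIso D inV₂ S41 ⊎ InducedIso D inV₂ S42 ⊎ InducedIso D inV₂ S43 →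
    HasStrongArcDecomposition D
  strong-arc-decomposition (inj₁ iso)               = S4-spanned (λ _ _ → ≤-refl) iso
  strong-arc-decomposition (inj₂ (inj₁ iso))        = S4-spanned S4≤S41 iso
  strong-arc-decomposition (inj₂ (inj₂ (inj₁ iso))) = S4-spanned S4≤S42 iso
  strong-arc-decomposition (inj₂ (inj₂ (inj₂ iso))) = S4-spanned S4≤S43 iso

lemma2p6 : (n : ℕ) (D : Multi n) (inV₂ : Fin n → Bool) →
    IsSplit D inV₂ →
    (∀ x → inV₂ x ≡ false → 3 ≤ outdeg D x × 3 ≤ indeg D x) →
    ((IsDigraph D × TwoArcStrong D × V₂size≤ inV₂ 3)
      ⊎ (SimpleOutsideV₂ D inV₂ ×
         (InducedIso D inV₂ S4 ⊎ InducedIso D inV₂ S41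
           ⊎ InducedIso D inV₂ S42 ⊎ InducedIso D inV₂ S43))) →
    HasStrongArcDecomposition D
lemma2p6 n D inV₂ ((_ , x₀∈V₁) , _ , independent , _) degrees
         (inj₁ (digraph , two-arc-strong , f , f-onto)) =
  Small-V₂.strong-arc-decomposition D inV₂ independent degrees digraph two-arc-strong x₀∈V₁ f f-onto
lemma2p6 n D inV₂ ((_ , x₀∈V₁) , _ , independent , _) degrees (inj₂ (simple , iso)) =
  Containing-S4.strong-arc-decomposition D inV₂ independent degrees simple x₀∈V₁ iso
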